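{- Let $(P,\leq)$ be a poset, $f \in \operatorname{Aut}(P)$, and $x,y,z \in P$ such that $x < z$, $x < f(y)$, $f(z) < z$, $y < f(y)$, $x$ is incomparable to $f(z)$, and $x$ is incomparable to $y$. Then $\operatorname{sp}(x,f) = \infty$, i.e. the orbit $f^{\mathbb{Z}}(x)$ is an infinite antichain.
   Context: The spiral length $\operatorname{sp}(x,f)$ is the least $n\ge1$ such that $x$ and $f^n(x)$ are comparable, or $\infty$ if no such $n$ exists; $f^{\mathbb{Z}}(x) = \{f^n(x): n\in\mathbb{Z}\}$. -}

module Defs where

open import Level using (Level; _⊔_)
open import Data.Nat using (ℕ; zero; suc)
open import Data.Sum using (_⊎_)
open import Relation.Nullary using (¬_)
open import Relation.Binary.Bundles using (Poset)
open import Relation.Binary.Morphism.Structures using (IsOrderIsomorphism)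

iter : ∀ {a} {A : Set a} → (A → A) → ℕ → A → A
iter f zero    x = x
iter f (suc n) x = f (iter f n x)

module _ {c ℓ₁ ℓ₂ : Level} (P : Poset c ℓ₁ ℓ₂) where
  open Poset P

  IsAut : (Carrier → Carrier) → Set (c ⊔ ℓ₁ ⊔ ℓ₂)
  IsAut f = IsOrderIsomorphism _≈_ _≈_ _≤_ _≤_ f

  Comparable : Carrier → Carrier → Set ℓ₂
  Comparable x y = x ≤ y ⊎ y ≤ x

  -- sp(x,f) = ∞ : no n ≥ 1 (written n = suc m) with x and fⁿ(x) comparable
  SpInfinite : Carrier → (Carrier → Carrier) → Set ℓ₂
  SpInfinite x f = ∀ n → ¬ Comparable x (iter f (suc n) x)

{-# OPTIONS --safe #-}
module Submission where

-- The point z drifts down and y drifts up under f.  If x ≤ fⁿ⁺¹(x), then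
-- x ≤ fⁿ⁺¹(x) ≤ fⁿ⁺¹(z) ≤ f(z), contradicting x ∥ f(z); if fⁿ⁺¹(x) ≤ x, then
-- fⁿ⁺¹(x) ≤ x ≤ f(y) ≤ fⁿ⁺¹(y), and reflecting along fⁿ⁺¹ gives x ≤ y,
-- contradicting x ∥ y.

open import Defs
open import Data.Product using (proj₁)
open import Data.Sum using (inj₁; inj₂)
open import Data.Nat using (zero; suc)
open import Relation.Nullary using (¬_)
open import Relation.Binary.Bundles using (Poset)
open import Relation.Binary.Morphism.Structures using (IsOrderIsomorphism)
import Relation.Binary.Properties.Poset as PP

module _ {c ℓ₁ ℓ₂} (P : Poset c ℓ₁ ℓ₂) {f : Poset.Carrier P → Poset.Carrier P} where
  open Poset P

  iter-mono : (∀ {a b} → a ≤ b → f a ≤ f b) →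
              ∀ n {a b} → a ≤ b → iter f n a ≤ iter f n b
  iter-mono mono zero    a≤b = a≤b
  iter-mono mono (suc n) a≤b = mono (iter-mono mono n a≤b)

  iter-cancel : (∀ {a b} → f a ≤ f b → a ≤ b) →
                ∀ n {a b} → iter f n a ≤ iter f n b → a ≤ b
  iter-cancel cancel zero    p = p
  iter-cancel cancel (suc n) p = iter-cancel cancel n (cancel p)

  iter-deflationary : (∀ {a b} → a ≤ b → f a ≤ f b) →
                      ∀ {a} → f a ≤ a → ∀ n → iter f n a ≤ a
  iter-deflationary mono fa≤a zero    = refl
  iter-deflationary mono fa≤a (suc n) = trans (mono (iter-deflationary mono fa≤a n)) fa≤a

  iter-inflationary : (∀ {a b} → a ≤ b → f a ≤ f b) →
                      ∀ {a} → a ≤ f a → ∀ n → a ≤ iter f n a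
  iter-inflationary mono a≤fa zero    = refl
  iter-inflationary mono a≤fa (suc n) = trans a≤fa (mono (iter-inflationary mono a≤fa n))

mainTheorem18 : ∀ {c ℓ₁ ℓ₂} (P : Poset c ℓ₁ ℓ₂) (f : Poset.Carrier P → Poset.Carrier P)
    → IsAut P f
    → (x y z : Poset.Carrier P)
    → PP._<_ P x z
    → PP._<_ P x (f y)
    → PP._<_ P (f z) z
    → PP._<_ P y (f y)
    → ¬ Comparable P x (f z)
    → ¬ Comparable P x y
    → SpInfinite P x f
mainTheorem18 P f aut x y z x<z x<fy fz<z y<fy x∥fz x∥y n = λ
  { (inj₁ x≤fⁿ⁺¹x) → x∥fz (inj₁ (trans x≤fⁿ⁺¹x fⁿ⁺¹x≤fz))
  ; (inj₂ fⁿ⁺¹x≤x) → x∥y (inj₁ (iter-cancel P cancel (suc n) (trans fⁿ⁺¹x≤x x≤fⁿ⁺¹y)))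
  }
  where
  open Poset P
  open IsOrderIsomorphism aut using (mono; cancel)

  fⁿ⁺¹x≤fz : iter f (suc n) x ≤ f z
  fⁿ⁺¹x≤fz = trans (iter-mono P mono (suc n) (proj₁ x<z))
                   (mono (iter-deflationary P mono (proj₁ fz<z) n))

  x≤fⁿ⁺¹y : x ≤ iter f (suc n) y
  x≤fⁿ⁺¹y = trans (proj₁ x<fy) (mono (iter-inflationary P mono (proj₁ y<fy) n))
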